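{- There exist $\alpha\in\Phi_{XY}$ and $\phi,\psi\in\Phi$ such that the inference from $[\alpha]\phi$ and $[\neg\alpha]\psi$ to $\Box\phi\lor\Box\psi$ is unsound; that is, there is a contextualized pointed model $(M,C,\pi,i)$ with $M,C,\pi,i\Vdash[\alpha]\phi$ and $M,C,\pi,i\Vdash[\neg\alpha]\psi$ but $M,C,\pi,i\not\Vdash\Box\phi\lor\Box\psi$.
   Context: Let $\mathsf{AP}$ be a countable set of atomic propositions. The language $\Phi_{XY}$ is given by $\alpha ::= p \mid \bot \mid \neg\alpha \mid (\alpha\land\alpha) \mid \mathtt{X}\alpha \mid \mathtt{Y}\alpha$ with $p\in\mathsf{AP}$. The language $\Phi$ is given by $\phi ::= p \mid \bot \mid \neg\phi \mid (\phi\land\phi) \mid \mathtt{X}\phi \mid \mathtt{Y}\phi \mid [\alpha]\phi$ with $\alpha\in\Phi_{XY}$. Abbreviations: $\top,\lor,\rightarrow,\leftrightarrow$ as usual; $\langle\alpha\rangle\phi:=\neg[\alpha]\neg\phi$; $\Box\phi:=[\top]\phi$; $\Diamond\phi:=\neg\Box\neg\phi$. A model is $M=(W,<,V)$ where $W$ is a nonempty set, $<$ is a serial binary relation on $W$ such that there is $r\in W$ (the root) with: for every $w\in W$ there is a unique finite sequence $x_0,\dots,x_n$ with $x_0=r$, $x_n=w$, $x_0<x_1<\dots<x_n$; and $V:\mathsf{AP}\to\mathcal P(W)$. A timeline is an infinite sequence $\pi=x_0,x_1,\dots$ with $x_0=r$ and $x_k<x_{k+1}$ for all $k$; $\pi[i]:=x_i$;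 $TL(M)$ is the set of timelines; instants are natural numbers. A context for $M$ is a finite (possibly empty) set $C$ of subsets of $TL(M)$; $AT(C):=TL(M)\cap\bigcap_{R\in C}R$. A contextualized pointed model is $(M,C,\pi,i)$ with $C$ a context for $M$, $\pi\in AT(C)$, $i\in\mathbb N$. Satisfaction $M,C,\pi,i\Vdash\phi$ (for $\pi\in TL(M)$): $p$ iff $\pi[i]\in V(p)$; $\bot$ never; $\neg,\land$ classically; $\mathtt{X}\phi$ iff $M,C,\pi,i+1\Vdash\phi$; $\mathtt{Y}\phi$ iff $i=0$ or $M,C,\pi,i-1\Vdash\phi$; $[\alpha]\phi$ iff $M,C^{\alpha}_i,\pi',i\Vdash\phi$ for every $\pi'\in AT(C^{\alpha}_i)$, where $C^{\alpha}_i:=C\cup\{\|\alpha\|_i\}$ and $\|\alpha\|_i:=\{\pi'\in TL(M): M,C,\pi',i\Vdash\alpha\}$. -}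

module Defs where

open import Data.Nat using (ℕ; zero; suc)
open import Data.List using (List; []; _∷_)
open import Data.Product using (Σ; ∃; _×_; _,_)
open import Data.Unit using (⊤)
open import Data.Empty using (⊥)
open import Relation.Nullary using (¬_)
open import Relation.Binary.PropositionalEquality using (_≡_)

AP : Set
AP = ℕ

data ΦXY : Set where
  atom : AP → ΦXY
  bot  : ΦXY
  neg  : ΦXY → ΦXY
  and  : ΦXY → ΦXY → ΦXY
  X    : ΦXY → ΦXY
  Y    : ΦXY → ΦXY

data Φ : Set where
  atom : AP → Φ
  bot  : Φ
  neg  : Φ → Φ
  and  : Φ → Φ → Φ
  X    : Φ → Φ
  Y    : Φ → Φ
  box  : ΦXY → Φ → Φ

topXY : ΦXY
topXY = neg bot

or : Φ → Φ → Φ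
or φ ψ = neg (and (neg φ) (neg ψ))

□ : Φ → Φ
□ φ = box topXY φ

ChainFrom : {W : Set} → (W → W → Set) → W → List W → W → Set
ChainFrom R x []       w = x ≡ w
ChainFrom R x (y ∷ ys) w = R x y × ChainFrom R y ys w

record Model : Set₁ where
  field
    W      : Set
    _<_    : W → W → Set
    serial : ∀ w → ∃ λ v → w < v
    root   : W
    V      : AP → W → Set

    chain-exists : ∀ w → ∃ λ ys → ChainFrom _<_ root ys w
    chain-unique : ∀ w ys zs → ChainFrom _<_ root ys w → ChainFrom _<_ root zs w → ys ≡ zs

module _ (M : Model) where
  open Model M

  record Timeline : Set where
    field
      seq   : ℕ → W
      start : seq 0 ≡ root
      step  : ∀ k → seq k < seq (suc k)

  open Timeline

  Context : Set₁
  Context = List (Timeline → Set)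

  AT : Context → Timeline → Set
  AT []      π = ⊤
  AT (R ∷ C) π = R π × AT C π

  SatXY : Timeline → ℕ → ΦXY → Set
  SatXY π i (atom p)  = V p (seq π i)
  SatXY π i bot       = ⊥
  SatXY π i (neg α)   = ¬ SatXY π i α
  SatXY π i (and α β) = SatXY π i α × SatXY π i β
  SatXY π i (X α)     = SatXY π (suc i) α
  SatXY π zero (Y α)    = ⊤
  SatXY π (suc i) (Y α) = SatXY π i α

  ext : ℕ → ΦXY → Timeline → Set
  ext i α π' = SatXY π' i α

  Sat : Context → Timeline → ℕ → Φ → Set
  Sat C π i (atom p)  = V p (seq π i)
  Sat C π i bot       = ⊥
  Sat C π i (neg φ)   = ¬ Sat C π i φ
  Sat C π i (and φ ψ) = Sat C π i φ × Sat C π i ψ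
  Sat C π i (X φ)     = Sat C π (suc i) φ
  Sat C π zero (Y φ)    = ⊤
  Sat C π (suc i) (Y φ) = Sat C π i φ
  Sat C π i (box α φ) =
    ∀ (π' : Timeline) → AT (ext i α ∷ C) π' → Sat (ext i α ∷ C) π' i φ

{-# OPTIONS --safe #-}
module Submission where

-- For every formula α of Φ_XY, [α]α and [¬α]¬α are valid, since announcing α
-- restricts attention to timelines on which α holds. But □α ∨ □¬α fails as soon
-- as α is not yet settled at the current instant: in a root with two branches,
-- α = X p (p true exactly on one branch) is true along one timeline and false
-- along the other.

open import Defs
open import Data.Bool using (Bool; true; false)
open import Data.Empty using (⊥; ⊥-elim)
open import Data.List using ([]; _∷_; _∷ʳ_)
open import Data.Nat using (ℕ; zero; suc; _≤_; _<_)
open import Data.Nat.Properties using (≤-refl; <⇒≤; <-irrefl; <-≤-trans; n<1+n)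
open import Data.Product using (Σ; ∃; _×_; _,_; proj₂)
open import Data.Product.Function.NonDependent.Propositional using (_×-⇔_)
open import Data.Unit using (⊤; tt)
open import Function.Bundles using (_⇔_; Equivalence)
open import Function.Construct.Identity using (⇔-id)
open import Function.Related.TypeIsomorphisms using (¬-cong-⇔)
open import Relation.Binary.PropositionalEquality using (_≡_; refl; sym; cong)
open import Relation.Nullary using (¬_)

module Chains {W : Set} (R : W → W → Set) where

  chain-snoc : ∀ {x ys w v} → ChainFrom R x ys w → R w v → ChainFrom R x (ys ∷ʳ v) v
  chain-snoc {ys = []}     refl       wRv = wRv , refl
  chain-snoc {ys = y ∷ ys} (xRy , yw) wRv = xRy , chain-snoc yw wRv

  module _ (rank : W → ℕ) (rank-suc : ∀ {x y} → R x y → rank y ≡ suc (rank x)) where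

    rank-< : ∀ {x y} → R x y → rank x < rank y
    rank-< xRy rewrite rank-suc xRy = n<1+n _

    rank-successors-≡ : ∀ {x x' y y'} → R x y → R x' y' → rank x ≡ rank x' → rank y ≡ rank y'
    rank-successors-≡ xRy x'Ry' rx≡rx' rewrite rank-suc xRy | rank-suc x'Ry' = cong suc rx≡rx'

    chain-rank-≤ : ∀ {x ys w} → ChainFrom R x ys w → rank x ≤ rank w
    chain-rank-≤ {ys = []}     refl       = ≤-refl
    chain-rank-≤ {ys = y ∷ ys} (xRy , yw) = <⇒≤ (<-≤-trans (rank-< xRy) (chain-rank-≤ yw))

    -- Induction runs towards the common endpoint, so the starting points are only
    -- assumed to have equal rank; equality of the starting points is then
    -- recovered from uniqueness of predecessors.
    chain-unique-by-rank :
      (∀ {x x' y} → R x y → R x' y → x ≡ x') →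
      ∀ {x x' ys zs w} → ChainFrom R x ys w → ChainFrom R x' zs w →
      rank x ≡ rank x' → x ≡ x' × ys ≡ zs
    chain-unique-by-rank pred-unique {ys = []} {[]} refl refl _ = refl , refl
    chain-unique-by-rank pred-unique {ys = []} {z ∷ zs} refl (x'Rz , zw) rx≡rx' =
      ⊥-elim (<-irrefl (sym rx≡rx') (<-≤-trans (rank-< x'Rz) (chain-rank-≤ zw)))
    chain-unique-by-rank pred-unique {ys = y ∷ ys} {[]} (xRy , yw) refl rx≡rx' =
      ⊥-elim (<-irrefl rx≡rx' (<-≤-trans (rank-< xRy) (chain-rank-≤ yw)))
    chain-unique-by-rank pred-unique {ys = y ∷ ys} {z ∷ zs} (xRy , yw) (x'Rz , zw) rx≡rx'
      with chain-unique-by-rank pred-unique yw zw (rank-successors-≡ xRy x'Rz rx≡rx')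
    ... | refl , refl = pred-unique xRy x'Rz , refl

embed : ΦXY → Φ
embed (atom p)  = atom p
embed bot       = bot
embed (neg α)   = neg (embed α)
embed (and α β) = and (embed α) (embed β)
embed (X α)     = X (embed α)
embed (Y α)     = Y (embed α)

module _ (M : Model) where
  open Equivalence

  Sat-embed : ∀ C π i α → Sat M C π i (embed α) ⇔ SatXY M π i α
  Sat-embed C π i       (atom p)  = ⇔-id _
  Sat-embed C π i       bot       = ⇔-id _
  Sat-embed C π i       (neg α)   = ¬-cong-⇔ (Sat-embed C π i α)
  Sat-embed C π i       (and α β) = Sat-embed C π i α ×-⇔ Sat-embed C π i β
  Sat-embed C π i       (X α)     = Sat-embed C π (suc i) α
  Sat-embed C π zero    (Y α)     = ⇔-id _
  Sat-embed C π (suc i) (Y α)     = Sat-embed C π i α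

  box-embed-self : ∀ C π i α → Sat M C π i (box α (embed α))
  box-embed-self C π i α π' (π'⊨α , _) = from (Sat-embed _ π' i α) π'⊨α

  ¬□-embed : ∀ C π i α π' → AT M C π' → ¬ SatXY M π' i α → ¬ Sat M C π i (□ (embed α))
  ¬□-embed C π i α π' π'∈C π'⊭α □α =
    π'⊭α (to (Sat-embed _ π' i α) (□α π' ((λ ()) , π'∈C)))

data Node : Set where
  root : Node
  node : Bool → ℕ → Node

data _⋖_ : Node → Node → Set where
  root⋖ : ∀ b → root ⋖ node b 0
  node⋖ : ∀ b n → node b n ⋖ node b (suc n)

depth : Node → ℕ
depth root       = 0
depth (node b n) = suc n

depth-⋖ : ∀ {x y} → x ⋖ y → depth y ≡ suc (depth x)
depth-⋖ (root⋖ b)   = refl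
depth-⋖ (node⋖ b n) = refl

⋖-pred-unique : ∀ {x x' y} → x ⋖ y → x' ⋖ y → x ≡ x'
⋖-pred-unique (root⋖ b)   (root⋖ .b)     = refl
⋖-pred-unique (node⋖ b n) (node⋖ .b .n) = refl

⋖-serial : ∀ w → ∃ λ v → w ⋖ v
⋖-serial root       = node true 0 , root⋖ true
⋖-serial (node b n) = node b (suc n) , node⋖ b n

open Chains _⋖_

chain-from-root : ∀ w → ∃ λ ys → ChainFrom _⋖_ root ys w
chain-from-root root             = [] , refl
chain-from-root (node b zero)    = node b 0 ∷ [] , root⋖ b , refl
chain-from-root (node b (suc n)) with chain-from-root (node b n)
... | ys , chain = ys ∷ʳ node b (suc n) , chain-snoc chain (node⋖ b n)

OnTrueBranch : Node → Set
OnTrueBranch (node true _) = ⊤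
OnTrueBranch _             = ⊥

twoBranches : Model
twoBranches = record
  { W            = Node
  ; _<_          = _⋖_
  ; serial       = ⋖-serial
  ; root         = root
  ; V            = λ _ → OnTrueBranch
  ; chain-exists = chain-from-root
  ; chain-unique = λ w ys zs p q →
      proj₂ (chain-unique-by-rank depth depth-⋖ ⋖-pred-unique p q refl)
  }

along : Bool → Timeline twoBranches
along b = record { seq = position ; start = refl ; step = advance }
  where
    position : ℕ → Node
    position zero    = root
    position (suc k) = node b k

    advance : ∀ k → position k ⋖ position (suc k)
    advance zero    = root⋖ b
    advance (suc k) = node⋖ b k

fact4 : Σ ΦXY λ α → Σ Φ λ φ → Σ Φ λ ψ →
    Σ Model λ M → Σ (Context M) λ C → Σ (Timeline M) λ π → Σ ℕ λ i →
    AT M C π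
    × Sat M C π i (box α φ)
    × Sat M C π i (box (neg α) ψ)
    × ¬ Sat M C π i (or (□ φ) (□ ψ))
fact4 =
  α , embed α , embed (neg α) , twoBranches , [] , π , 0 ,
  tt ,
  box-embed-self twoBranches [] π 0 α ,
  box-embed-self twoBranches [] π 0 (neg α) ,
  λ □α∨□¬α → □α∨□¬α (¬□α , ¬□¬α)
  where
    α : ΦXY
    α = X (atom 0)

    π : Timeline twoBranches
    π = along true

    ¬□α : ¬ Sat twoBranches [] π 0 (□ (embed α))
    ¬□α = ¬□-embed twoBranches [] π 0 α (along false) tt (λ ())

    ¬□¬α : ¬ Sat twoBranches [] π 0 (□ (embed (neg α)))
    ¬□¬α = ¬□-embed twoBranches [] π 0 (neg α) (along true) tt (λ ¬α → ¬α tt)
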